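{- Let $h:\mathbb{N}\to\mathbb{N}$ be inflationary (i.e. $h(m)\ge m$ for all $m$) and let $\mathcal{O}$ be a collection of set-functions each of which is $h$-continuous on its whole domain. Let $k\ge1$ and $f:\mathbb{N}^k\to\mathbb{N}$ be such that for every $q\ge0$ the set $\{f(\vec n)\mid \vec n\in\mathbb{N}^k,\ h^{(q)}(f(\vec n))<\min(\vec n)\}$ is infinite, where $h^{(q)}$ is the $q$-fold iterate of $h$ ($h^{(0)}$ the identity). Then $f$ is not $(\mathcal{O},\mathcal{P})$-definable.
   Context: $\mathbb{N}=\{0,1,2,\ldots\}$, $2^{\mathbb{N}}$ is its power set. A set-function is a map $(2^{\mathbb{N}})^j\to 2^{\mathbb{N}}$ for some $j\ge 0$. For a collection $\mathcal{C}$ of set-functions, $\mathcal{C}$-circuits are terms built from variables ranging over $2^{\mathbb{N}}$, the constants $\emptyset$, $\mathbb{N}$, $\{n\}$ ($n\in\mathbb{N}$), the operations $\cup$, $\cap$, complement relative to $\mathbb{N}$, and the functions in $\mathcal{C}$; a circuit with variables $x_1,\ldots,x_k$ defines the function obtained by evaluation. $(\mathcal{O},\mathcal{P})$-circuits are $(\mathcal{O}\cup\mathcal{P})$-circuits. A numerical function $f:\mathbb{N}^k\to\mathbb{N}$ is $\mathcal{C}$-definable if some $\mathcal{C}$-circuit $\tau(x_1,\ldots,x_k)$ satisfies $\tau(\{m_1\},\ldots,\{m_k\})=\{f(m_1,\ldots,m_k)\}$ for all $m_1,\ldots,m_k\in\mathbb{N}$ (values on non-singleton inputs are irrelevant). For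 $s\subseteq\mathbb{N}$, $s_{|m}=s\cap\{0,\ldots,m\}$, componentwise on tuples. A set-function $F$ is $h$-continuous on a domain $D$ if for all $m\in\mathbb{N}$ and all $\vec s,\vec t\in D$, $\vec s_{|h(m)}=\vec t_{|h(m)}$ implies $F(\vec s)_{|m}=F(\vec t)_{|m}$. $\mathcal{P}$ is the collection of all set-functions (all arities) whose values all lie in $\{\emptyset,\{0\}\}$. For a tuple $\vec n$, $\min(\vec n)$ is its least entry. -}

module Defs where

open import Data.Nat using (ℕ; zero; suc; _≤_; _<_; _⊓_; _≡ᵇ_)
open import Data.Bool using (Bool; true; false; _∨_; _∧_; not)
open import Data.Fin using (Fin; zero; suc)
open import Data.Sum using (_⊎_)
open import Data.Product using (Σ; _×_; ∃)
open import Relation.Nullary using (¬_)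
open import Relation.Binary.PropositionalEquality using (_≡_)

SetN : Set
SetN = ℕ → Bool

_≈ₛ_ : SetN → SetN → Set
s ≈ₛ t = ∀ n → s n ≡ t n

∅ₛ : SetN
∅ₛ _ = false

ℕₛ : SetN
ℕₛ _ = true

⟦_⟧ₛ : ℕ → SetN
⟦ m ⟧ₛ n = n ≡ᵇ m

_∪ₛ_ : SetN → SetN → SetN
(s ∪ₛ t) n = s n ∨ t n

_∩ₛ_ : SetN → SetN → SetN
(s ∩ₛ t) n = s n ∧ t n

∁ₛ : SetN → SetN
∁ₛ s n = not (s n)

SetFun : ℕ → Set
SetFun j = (Fin j → SetN) → SetN

Collection : Set₁
Collection = (j : ℕ) → SetFun j → Set

-- Union of two collections: (𝒪,𝒫)-circuits are (𝒪 ∪ 𝒫)-circuits.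
_∪ᶜ_ : Collection → Collection → Collection
(O ∪ᶜ P) j F = O j F ⊎ P j F

𝒫 : Collection
𝒫 j F = ∀ (s : Fin j → SetN) → (F s ≈ₛ ∅ₛ) ⊎ (F s ≈ₛ ⟦ 0 ⟧ₛ)

data Circuit (C : Collection) (k : ℕ) : Set₁ where
  var   : Fin k → Circuit C k
  empty : Circuit C k
  full  : Circuit C k
  sing  : ℕ → Circuit C k
  union : Circuit C k → Circuit C k → Circuit C k
  inter : Circuit C k → Circuit C k → Circuit C k
  compl : Circuit C k → Circuit C k
  app   : (j : ℕ) (F : SetFun j) → C j F → (Fin j → Circuit C k) → Circuit C k

eval : ∀ {C k} → Circuit C k → (Fin k → SetN) → SetN
eval (var i) ρ = ρ i
eval empty ρ = ∅ₛ
eval full ρ = ℕₛ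
eval (sing n) ρ = ⟦ n ⟧ₛ
eval (union a b) ρ = eval a ρ ∪ₛ eval b ρ
eval (inter a b) ρ = eval a ρ ∩ₛ eval b ρ
eval (compl a) ρ = ∁ₛ (eval a ρ)
eval (app j F _ args) ρ = F (λ i → eval (args i) ρ)

Definable : (C : Collection) (k : ℕ) → ((Fin k → ℕ) → ℕ) → Set₁
Definable C k f = Σ (Circuit C k) λ τ →
  ∀ (m : Fin k → ℕ) → eval τ (λ i → ⟦ m i ⟧ₛ) ≈ₛ ⟦ f m ⟧ₛ

Continuous : (h : ℕ → ℕ) {j : ℕ} → SetFun j → Set
Continuous h {j} F = ∀ (m : ℕ) (s t : Fin j → SetN) →
  (∀ (i : Fin j) (n : ℕ) → n ≤ h m → s i n ≡ t i n) →
  ∀ (n : ℕ) → n ≤ m → F s n ≡ F t n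

Inflationary : (ℕ → ℕ) → Set
Inflationary h = ∀ m → m ≤ h m

iter : (ℕ → ℕ) → ℕ → ℕ → ℕ
iter h zero x = x
iter h (suc q) x = h (iter h q x)

minTuple : (k : ℕ) → (Fin (suc k) → ℕ) → ℕ
minTuple zero v = v zero
minTuple (suc k) v = v zero ⊓ minTuple k (λ i → v (suc i))

Infinite : (ℕ → Set) → Set
Infinite S = ∀ (b : ℕ) → ∃ λ x → S x × b ≤ x

module Submission where

-- Let τ be an (𝒪,𝒫)-circuit and let d be its 𝒪-depth, the
-- largest number of nested 𝒪-gates (𝒫-gates do not count: their outputs are
-- ∅ or {0}, so they have only two possible values anyway).  By induction on
-- τ we attach to it a finite list of sets, its candidates, and show:
--   whenever all inputs avoid [0, h^(d)(m)], the value of τ agrees on [0, m]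
--   with one of its candidates
-- (h-continuity of an 𝒪-gate costs one application of h per level).
-- If τ defined f, then for every tuple n with h^(d)(f n) < min n the
-- singleton inputs avoid [0, h^(d)(f n)], so some candidate has least
-- element f n.  A fixed set has at most one least element, so finitely many
-- candidates cannot account for the infinitely many such values f n that
-- the hypothesis provides.

open import Defs
open import Data.Nat using (ℕ; zero; suc; _<_; _≤_; _⊔_; _≡ᵇ_; _≟_; s≤s)
open import Data.Nat.Properties
open import Data.Bool using (Bool; true; false; _∨_; _∧_; not)
open import Data.Fin using (Fin; zero; suc)
open import Data.Vec.Functional using () renaming (_∷_ to _∷ᶠ_)
open import Data.Sum using (_⊎_; inj₁; inj₂)
open import Data.Product using (∃; _×_; _,_)
open import Data.List using (List; []; _∷_; map; cartesianProductWith)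
open import Data.List.Membership.Propositional using (_∈_)
open import Data.List.Membership.Propositional.Properties using (∈-map⁺; ∈-cartesianProductWith⁺)
open import Data.List.Relation.Unary.Any using (here; there)
open import Relation.Nullary using (¬_; contradiction)
open import Relation.Nullary.Decidable using (dec-true; dec-false)
open import Relation.Binary.PropositionalEquality using (_≡_; refl; sym; trans; cong; cong₂; subst; subst₂)

true≢false : ¬ true ≡ false
true≢false ()

≡ᵇ-refl : ∀ y → (y ≡ᵇ y) ≡ true
≡ᵇ-refl y = dec-true (y ≟ y) refl

≡ᵇ-<-false : ∀ {a b} → a < b → (a ≡ᵇ b) ≡ false
≡ᵇ-<-false {a} {b} a<b = dec-false (a ≟ b) (<⇒≢ a<b)

AgreeUpTo : ℕ → SetN → SetN → Set
AgreeUpTo m s t = ∀ n → n ≤ m → s n ≡ t n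

LeastElement : SetN → ℕ → Set
LeastElement G y = AgreeUpTo y G ⟦ y ⟧ₛ

-- Of two distinct numbers, at least one is not the least element of G;
-- which one is decided by looking at G at the smaller number.
least-element-sparse : ∀ G {y y'} → y < y' → ¬ LeastElement G y ⊎ ¬ LeastElement G y'
least-element-sparse G {y} {y'} y<y' with G y in Gy
... | false = inj₁ λ least → true≢false (trans (sym (≡ᵇ-refl y)) (trans (sym (least y ≤-refl)) Gy))
... | true  = inj₂ λ least → true≢false (trans (sym Gy) (trans (least y (<⇒≤ y<y')) (≡ᵇ-<-false y<y')))

Sparse : {A : Set} → (A → ℕ → Set) → Set
Sparse {A} R = ∀ (G : A) {y y'} → y < y' → ¬ R G y ⊎ ¬ R G y'

infinite-minus-sparse : {A : Set} {R : A → ℕ → Set} → Sparse R → (G : A) {S : ℕ → Set} →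
  Infinite S → Infinite (λ y → S y × ¬ R G y)
infinite-minus-sparse sparse G inf b with inf b
... | y , Sy , b≤y with inf (suc y)
... | y' , Sy' , y<y' with sparse G y<y'
... | inj₁ ¬Ry  = y  , (Sy  , ¬Ry)  , b≤y
... | inj₂ ¬Ry' = y' , (Sy' , ¬Ry') , ≤-trans b≤y (<⇒≤ y<y')

no-finite-cover : {A : Set} {R : A → ℕ → Set} → Sparse R → (Gs : List A) {S : ℕ → Set} →
  Infinite S → ¬ (∀ y → S y → ∃ λ G → G ∈ Gs × R G y)
no-finite-cover sparse [] inf cover with inf 0
... | y , Sy , _ with cover y Sy
... | _ , () , _
no-finite-cover {R = R} sparse (G ∷ Gs) {S} inf cover =
  no-finite-cover sparse Gs (infinite-minus-sparse sparse G inf) cover-rest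
  where
  cover-rest : ∀ y → S y × ¬ R G y → ∃ λ G' → G' ∈ Gs × R G' y
  cover-rest y (Sy , ¬RGy) with cover y Sy
  ... | _ , here refl , RGy = contradiction RGy ¬RGy
  ... | G' , there G'∈ , RG'y = G' , G'∈ , RG'y

selections : {A : Set} (j : ℕ) → (Fin j → List A) → List (Fin j → A)
selections zero    L = (λ ()) ∷ []
selections (suc j) L = cartesianProductWith _∷ᶠ_ (L zero) (selections j (λ i → L (suc i)))

selections-complete : {A : Set} (j : ℕ) (L : Fin j → List A) (P : Fin j → A → Set) →
  (∀ i → ∃ λ a → a ∈ L i × P i a) → ∃ λ g → g ∈ selections j L × (∀ i → P i (g i))
selections-complete zero    L P choose = (λ ()) , here refl , λ ()
selections-complete (suc j) L P choose
  with choose zero | selections-complete j (λ i → L (suc i)) (λ i → P (suc i)) (λ i → choose (suc i))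
... | a , a∈ , Pa | g , g∈ , Pg = a ∷ᶠ g , ∈-cartesianProductWith⁺ _∷ᶠ_ a∈ g∈ , P-everywhere
  where
  P-everywhere : ∀ i → P i ((a ∷ᶠ g) i)
  P-everywhere zero    = Pa
  P-everywhere (suc i) = Pg i

maxOf : (j : ℕ) → (Fin j → ℕ) → ℕ
maxOf zero    d = 0
maxOf (suc j) d = d zero ⊔ maxOf j (λ i → d (suc i))

≤-maxOf : ∀ j (d : Fin j → ℕ) i → d i ≤ maxOf j d
≤-maxOf (suc j) d zero    = m≤m⊔n _ _
≤-maxOf (suc j) d (suc i) = ≤-trans (≤-maxOf j (λ i → d (suc i)) i) (m≤n⊔m _ _)

minTuple-≤ : ∀ k (v : Fin (suc k) → ℕ) i → minTuple k v ≤ v i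
minTuple-≤ zero    v zero    = ≤-refl
minTuple-≤ (suc k) v zero    = m⊓n≤m _ _
minTuple-≤ (suc k) v (suc i) = ≤-trans (m⊓n≤n _ _) (minTuple-≤ k (λ i → v (suc i)) i)

VanishUpTo : ∀ {K} → (Fin K → SetN) → ℕ → Set
VanishUpTo ρ B = ∀ i n → n ≤ B → ρ i n ≡ false

vanish-≤ : ∀ {K} (ρ : Fin K → SetN) {B B'} → B ≤ B' → VanishUpTo ρ B' → VanishUpTo ρ B
vanish-≤ ρ B≤B' vanish i n n≤B = vanish i n (≤-trans n≤B B≤B')

singletons-vanish : ∀ k (v : Fin (suc k) → ℕ) {B} → B < minTuple k v → VanishUpTo (λ i → ⟦ v i ⟧ₛ) B
singletons-vanish k v B<min i n n≤B = ≡ᵇ-<-false (≤-<-trans n≤B (<-≤-trans B<min (minTuple-≤ k v i)))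

module Iterates (h : ℕ → ℕ) (infl : Inflationary h) where

  iter-suc : ∀ d m → iter h (suc d) m ≡ iter h d (h m)
  iter-suc zero    m = refl
  iter-suc (suc d) m = cong h (iter-suc d m)

  iter-inflationary : ∀ d m → m ≤ iter h d m
  iter-inflationary zero    m = ≤-refl
  iter-inflationary (suc d) m = ≤-trans (iter-inflationary d m) (infl _)

  -- h itself need not be monotone, so induction shifts the starting point.
  iter-mono : ∀ {d d'} m → d ≤ d' → iter h d m ≤ iter h d' m
  iter-mono {zero}  {d'}     m _         = iter-inflationary d' m
  iter-mono {suc d} {suc d'} m (s≤s d≤d') =
    subst₂ _≤_ (sym (iter-suc d m)) (sym (iter-suc d' m)) (iter-mono (h m) d≤d')

module Approximation (h : ℕ → ℕ) (infl : Inflationary h) (O : Collection)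
  (O-continuous : ∀ (j : ℕ) (F : SetFun j) → O j F → Continuous h F) where

  open Iterates h infl

  C : Collection
  C = O ∪ᶜ 𝒫

  depth : ∀ {K} → Circuit C K → ℕ
  depth (var i)                  = 0
  depth empty                    = 0
  depth full                     = 0
  depth (sing n)                 = 0
  depth (union a b)              = depth a ⊔ depth b
  depth (inter a b)              = depth a ⊔ depth b
  depth (compl a)                = depth a
  depth (app j F (inj₁ _) args)  = suc (maxOf j (λ i → depth (args i)))
  depth (app j F (inj₂ _) args)  = 0

  candidates : ∀ {K} → Circuit C K → List SetN
  candidates (var i)                 = ∅ₛ ∷ []
  candidates empty                   = ∅ₛ ∷ []
  candidates full                    = ℕₛ ∷ []
  candidates (sing n)                = ⟦ n ⟧ₛ ∷ []
  candidates (union a b)             = cartesianProductWith _∪ₛ_ (candidates a) (candidates b)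
  candidates (inter a b)             = cartesianProductWith _∩ₛ_ (candidates a) (candidates b)
  candidates (compl a)               = map ∁ₛ (candidates a)
  candidates (app j F (inj₁ _) args) = map F (selections j (λ i → candidates (args i)))
  candidates (app j F (inj₂ _) args) = ∅ₛ ∷ ⟦ 0 ⟧ₛ ∷ []

  Approximates : ∀ {K} → Circuit C K → (Fin K → SetN) → SetN → Set
  Approximates τ ρ G = ∀ m → VanishUpTo ρ (iter h (depth τ) m) → AgreeUpTo m (eval τ ρ) G

  vanish-iter : ∀ {K} (ρ : Fin K → SetN) {d d'} m → d ≤ d' →
    VanishUpTo ρ (iter h d' m) → VanishUpTo ρ (iter h d m)
  vanish-iter ρ m d≤d' = vanish-≤ ρ (iter-mono m d≤d')

  pointwise : (Bool → Bool → Bool) → SetN → SetN → SetN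
  pointwise op s t n = op (s n) (t n)

  approximates-pointwise : ∀ {K} (op : Bool → Bool → Bool) (a b : Circuit C K) (ρ : Fin K → SetN)
    {Ga Gb : SetN} → Approximates a ρ Ga → Approximates b ρ Gb →
    ∀ m → VanishUpTo ρ (iter h (depth a ⊔ depth b) m) →
    AgreeUpTo m (pointwise op (eval a ρ) (eval b ρ)) (pointwise op Ga Gb)
  approximates-pointwise op a b ρ approx-a approx-b m vanish n n≤m =
    cong₂ op (approx-a m (vanish-iter ρ m (m≤m⊔n (depth a) (depth b)) vanish) n n≤m)
             (approx-b m (vanish-iter ρ m (m≤n⊔m (depth a) (depth b)) vanish) n n≤m)

  -- An h-continuous gate preserves approximation at one more level of depth:
  -- agreement of the arguments on [0, h(m)] gives agreement on [0, m].
  approximates-gate : ∀ {K j} (F : SetFun j) → O j F → (args : Fin j → Circuit C K)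
    (ρ : Fin K → SetN) (g : Fin j → SetN) → (∀ i → Approximates (args i) ρ (g i)) →
    ∀ m → VanishUpTo ρ (iter h (suc (maxOf j (λ i → depth (args i)))) m) →
    AgreeUpTo m (F (λ i → eval (args i) ρ)) (F g)
  approximates-gate {j = j} F o args ρ g approx m vanish =
    O-continuous j F o m (λ i → eval (args i) ρ) g λ i →
      approx i (h m) (vanish-iter ρ (h m) (≤-maxOf j depths i) vanish-shifted)
    where
    depths : Fin j → ℕ
    depths i = depth (args i)
    vanish-shifted : VanishUpTo ρ (iter h (maxOf j depths) (h m))
    vanish-shifted = subst (VanishUpTo ρ) (iter-suc (maxOf j depths) m) vanish

  approximation : ∀ {K} (τ : Circuit C K) (ρ : Fin K → SetN) →
    ∃ λ G → G ∈ candidates τ × Approximates τ ρ G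
  approximation (var i)  ρ = ∅ₛ , here refl , λ m vanish n n≤m → vanish i n n≤m
  approximation empty    ρ = ∅ₛ , here refl , λ _ _ _ _ → refl
  approximation full     ρ = ℕₛ , here refl , λ _ _ _ _ → refl
  approximation (sing k) ρ = ⟦ k ⟧ₛ , here refl , λ _ _ _ _ → refl
  approximation (union a b) ρ with approximation a ρ | approximation b ρ
  ... | Ga , Ga∈ , approx-a | Gb , Gb∈ , approx-b =
    Ga ∪ₛ Gb , ∈-cartesianProductWith⁺ _∪ₛ_ Ga∈ Gb∈ , approximates-pointwise _∨_ a b ρ approx-a approx-b
  approximation (inter a b) ρ with approximation a ρ | approximation b ρ
  ... | Ga , Ga∈ , approx-a | Gb , Gb∈ , approx-b =
    Ga ∩ₛ Gb , ∈-cartesianProductWith⁺ _∩ₛ_ Ga∈ Gb∈ , approximates-pointwise _∧_ a b ρ approx-a approx-b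
  approximation (compl a) ρ with approximation a ρ
  ... | Ga , Ga∈ , approx-a = ∁ₛ Ga , ∈-map⁺ ∁ₛ Ga∈ , λ m vanish n n≤m → cong not (approx-a m vanish n n≤m)
  approximation (app j F (inj₂ F∈𝒫) args) ρ with F∈𝒫 (λ i → eval (args i) ρ)
  ... | inj₁ F≈∅ = ∅ₛ , here refl , λ _ _ n _ → F≈∅ n
  ... | inj₂ F≈0 = ⟦ 0 ⟧ₛ , there (here refl) , λ _ _ n _ → F≈0 n
  approximation (app j F (inj₁ F∈O) args) ρ
    with selections-complete j (λ i → candidates (args i)) (λ i → Approximates (args i) ρ)
                               (λ i → approximation (args i) ρ)
  ... | g , g∈ , approx-g = F g , ∈-map⁺ F g∈ , approximates-gate F F∈O args ρ g approx-g

  candidate-with-least-element : ∀ {K} (τ : Circuit C K) (ρ : Fin K → SetN) (y : ℕ) →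
    VanishUpTo ρ (iter h (depth τ) y) → eval τ ρ ≈ₛ ⟦ y ⟧ₛ →
    ∃ λ G → G ∈ candidates τ × LeastElement G y
  candidate-with-least-element τ ρ y vanish τ≈y with approximation τ ρ
  ... | G , G∈ , approx = G , G∈ , λ n n≤y → trans (sym (approx y vanish n n≤y)) (τ≈y n)

theorem7 : (h : ℕ → ℕ) → Inflationary h →
    (O : Collection) → (∀ (j : ℕ) (F : SetFun j) → O j F → Continuous h F) →
    (k : ℕ) (f : (Fin (suc k) → ℕ) → ℕ) →
    (∀ (q : ℕ) → Infinite (λ y → ∃ λ (n : Fin (suc k) → ℕ) →
    (f n ≡ y) × (iter h q (f n) < minTuple k n))) →
    ¬ Definable (O ∪ᶜ 𝒫) (suc k) f
theorem7 h infl O O-continuous k f infinitely-many (τ , τ-defines-f) =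
  no-finite-cover least-element-sparse (candidates τ) (infinitely-many (depth τ)) covered
  where
  open Approximation h infl O O-continuous
  covered : ∀ y → (∃ λ (n : Fin (suc k) → ℕ) → (f n ≡ y) × (iter h (depth τ) (f n) < minTuple k n)) →
    ∃ λ G → G ∈ candidates τ × LeastElement G y
  covered .(f n) (n , refl , small) =
    candidate-with-least-element τ (λ i → ⟦ n i ⟧ₛ) (f n) (singletons-vanish k n small) (τ-defines-f n)
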